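{- Let $(G,\chi)$ be a colored graph such that $|V(G)|>1$, $G$ is connected, and $\chi$ is stable with respect to $1$-WL. Let $S\subseteq V(G)$ be a vertex cover of $G$ and $I:=V(G)\setminus S$. Then either there are colors $c,d\in\mathrm{im}(\chi)$ with $|\chi^{ -1}(c)\cup\chi^{ -1}(d)|\ge2$ such that $vw\in E(G)$ for all distinct $v\in\chi^{ -1}(c)$, $w\in\chi^{ -1}(d)$; or there is a vertex $u\in V(G)$ such that, for $\chi'(v):=\mathrm{WL}_1(G,\chi[u])(v)$, one of the following holds: (a) $|\chi'(S)|\ge|\chi(S)|+2$ and $|\chi'(S)\setminus\chi'(I)|\ge|\chi(S)\setminus\chi(I)|+1$; (b) $|\chi'(S)|\ge|\chi(S)|+1$ and $|\chi'(S)\setminus\chi'(I)|\ge|\chi(S)\setminus\chi(I)|+2$; (c) $\chi'(S)\cap\chi'(I)=\emptyset$.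
   Context: $1$-WL (color refinement) iteratively recolors each vertex by (old color, multiset of neighbors' old colors) until the partition stabilizes; $\mathrm{WL}_1(G,\chi)(v)$ is the resulting stable color. $\chi$ is stable with respect to $1$-WL if refinement does not split its color classes. $\chi[u]$ gives $u$ a new unique color. For a set $X$, $\chi(X)=\{\chi(x)\mid x\in X\}$. A vertex cover is a set of vertices meeting every edge. -}

module Defs where

open import Data.Bool using (Bool; true; false; _∧_; not; if_then_else_)
open import Data.Nat using (ℕ; zero; suc; _≡ᵇ_)
import Data.Nat as ℕ
open import Data.Fin using (Fin; _≟_)
open import Data.List using (List; length; map; filterᵇ; takeWhileᵇ; deduplicate; []; _∷_)
open import Data.List.Membership.DecPropositional ℕ._≟_ using (_∈?_)
open import Data.List.Relation.Unary.Any using (any?)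
open import Data.List.Base using (filter)
open import Data.Fin.Base using (toℕ)
open import Data.List using (allFin)
open import Relation.Nullary using (¬_; ¬?)
open import Relation.Nullary.Decidable using (⌊_⌋)
open import Relation.Binary.PropositionalEquality using (_≡_)

record Graph (n : ℕ) : Set where
  field
    adj    : Fin n → Fin n → Bool
    sym    : ∀ v w → adj v w ≡ adj w v
    irrefl : ∀ v → adj v v ≡ false
open Graph public

Coloring : ℕ → Set
Coloring n = Fin n → ℕ

data Walk {n : ℕ} (G : Graph n) : Fin n → Fin n → Set where
  here : ∀ {v} → Walk G v v
  step : ∀ {u v w} → adj G u v ≡ true → Walk G v w → Walk G u w

Connected : ∀ {n} → Graph n → Set
Connected {n} G = ∀ (v w : Fin n) → Walk G v w

allᵇ : {A : Set} → (A → Bool) → List A → Bool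
allᵇ p [] = true
allᵇ p (x ∷ xs) = p x ∧ allᵇ p xs

nbCount : ∀ {n} → Graph n → Fin n → (Fin n → Bool) → ℕ
nbCount {n} G v p = length (filterᵇ (λ y → adj G v y ∧ p y) (allFin n))

Stable : ∀ {n} → Graph n → Coloring n → Set
Stable G χ = ∀ v w → χ v ≡ χ w → ∀ (c : ℕ) →
  nbCount G v (λ y → χ y ≡ᵇ c) ≡ nbCount G w (λ y → χ y ≡ᵇ c)

wlEq : ∀ {n} → Graph n → Coloring n → ℕ → Fin n → Fin n → Bool
wlEq G χ zero v w = χ v ≡ᵇ χ w
wlEq {n} G χ (suc k) v w =
  wlEq G χ k v w ∧
  allᵇ (λ x → nbCount G v (λ y → wlEq G χ k y x) ≡ᵇ nbCount G w (λ y → wlEq G χ k y x))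
      (allFin n)

-- After n rounds the partition on n vertices
-- is stable; the colour of v is the index of the first vertex in v's class
-- (a canonical naming of the stable colour classes).
WL1 : ∀ {n} → Graph n → Coloring n → Coloring n
WL1 {n} G χ v = length (takeWhileᵇ (λ x → not (wlEq G χ n x v)) (allFin n))

individualize : ∀ {n} → Coloring n → Fin n → Coloring n
individualize χ u v = if ⌊ v ≟ u ⌋ then 0 else suc (χ v)

VSet : ℕ → Set
VSet n = Fin n → Bool

complement : ∀ {n} → VSet n → VSet n
complement X v = not (X v)

VertexCover : ∀ {n} → Graph n → VSet n → Set
VertexCover G S = ∀ v w → adj G v w ≡ true → (S v ≡ true) Data.Sum.⊎ (S w ≡ true)
  where import Data.Sum

image : ∀ {n} → Coloring n → VSet n → List ℕ
image {n} χ X = deduplicate ℕ._≟_ (map χ (filterᵇ X (allFin n)))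

∣img∣ : ∀ {n} → Coloring n → VSet n → ℕ
∣img∣ χ X = length (image χ X)

∣img-diff∣ : ∀ {n} → Coloring n → VSet n → VSet n → ℕ
∣img-diff∣ χ X Y = length (filter (λ c → ¬? (c ∈? image χ Y)) (image χ X))

∣preimage2∣ : ∀ {n} → Coloring n → ℕ → ℕ → ℕ
∣preimage2∣ {n} χ c d = length (filterᵇ (λ v → (χ v ≡ᵇ c) Data.Bool.∨ (χ v ≡ᵇ d)) (allFin n))
  where import Data.Bool

-- If S contains no edge, every edge joins S to its complement; after individualising any vertex u
-- the stable colouring still sees the length of walks from u, hence the side, and (c) holds. If no
-- colour meets both S and its complement, (c) holds for any u as well. Otherwise, by connectivity,
-- some u ∈ S has a colour that also occurs outside S and a neighbour w ∈ S. Individualising u makes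
-- its colour exclusive to S and splits every colour class by adjacency to u. Either u's class is
-- completely joined to w's, or the non-neighbours of u coloured like w, compared through stability
-- (equally coloured vertices have equally many neighbours of each colour), yield the further splits
-- and exclusive colours needed for (a) or (b).

module Submission where

open import Defs hiding (sym)
open import Data.Bool using (Bool; true; false; _∧_; _∨_; not; if_then_else_)
import Data.Bool as Bool
open import Data.Bool.Properties using (∧-zeroʳ; ∨-zeroʳ; ∧-conicalˡ; ∧-conicalʳ; ¬-not; T-≡)
open import Data.Empty using (⊥-elim)
open import Data.Fin using (Fin; _≟_)
import Data.Fin as Fin
open import Data.Fin.Properties using (any?)
open import Data.List using (List; []; _∷_; _++_; length; map; filter; filterᵇ; deduplicate; allFin; takeWhileᵇ)
open import Data.List.Membership.Propositional using (_∈_; _∉_)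
open import Data.List.Membership.Propositional.Properties
  using (∈-filter⁺; ∈-filter⁻; ∈-deduplicate⁺; ∈-deduplicate⁻; ∈-map⁺; ∈-map⁻; ∈-++⁻; ∈-allFin)
open import Data.List.Properties using (length-++; length-map; length-filter; length-tabulate)
open import Data.List.Relation.Binary.Subset.Propositional using (_⊆_)
open import Data.List.Relation.Unary.All as All using (All; []; _∷_)
open import Data.List.Relation.Unary.All.Properties using () renaming (map⁺ to All-map⁺)
open import Data.List.Relation.Unary.AllPairs using ([]; _∷_)
open import Data.List.Relation.Unary.Any using (here; there)
open import Data.List.Relation.Unary.Unique.Propositional using (Unique)
import Data.List.Relation.Unary.Unique.Propositional.Properties as Unique
open import Data.List.Relation.Unary.Unique.DecPropositional.Properties using (deduplicate-!)
open import Data.Nat using (ℕ; zero; suc; _≤_; _<_; _+_; z≤n; s≤s; _≡ᵇ_)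
import Data.Nat as ℕ
open import Data.Nat.Properties hiding (_≟_)
open import Data.List.Membership.DecPropositional ℕ._≟_ using (_∈?_)
open import Data.Product using (Σ; ∃; _×_; _,_; proj₁; proj₂)
open import Data.Sum using (_⊎_; inj₁; inj₂)
open import Function using (Equivalence; _∘_; case_of_)
open import Relation.Binary.Definitions using (DecidableEquality)
open import Relation.Binary.PropositionalEquality
open import Relation.Nullary using (¬_; Dec; yes; no; ¬?; does)
open import Relation.Nullary.Decidable using (_×-dec_; dec-true; dec-false)

true≢false : true ≢ false
true≢false ()

not-true : ∀ {b} → not b ≡ true → b ≡ false
not-true {false} _ = refl

∧-true⁻ : ∀ {a b} → a ∧ b ≡ true → a ≡ true × b ≡ true
∧-true⁻ {a} {b} ab = ∧-conicalˡ a b ab , ∧-conicalʳ a b ab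

≡ᵇ-true⇒≡ : ∀ m n → (m ≡ᵇ n) ≡ true → m ≡ n
≡ᵇ-true⇒≡ m n e = ≡ᵇ⇒≡ m n (Equivalence.from T-≡ e)

≡⇒≡ᵇ-true : ∀ m n → m ≡ n → (m ≡ᵇ n) ≡ true
≡⇒≡ᵇ-true m n e = Equivalence.to T-≡ (≡⇒≡ᵇ m n e)

bool-ext : ∀ {a b} → (a ≡ true → b ≡ true) → (b ≡ true → a ≡ true) → a ≡ b
bool-ext {true}  {true}  _   _   = refl
bool-ext {true}  {false} a⇒b _   = sym (a⇒b refl)
bool-ext {false} {true}  _   b⇒a = b⇒a refl
bool-ext {false} {false} _   _   = refl

allᵇ⁺ : ∀ {A : Set} (p : A → Bool) xs → (∀ x → x ∈ xs → p x ≡ true) → allᵇ p xs ≡ true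
allᵇ⁺ p []       _   = refl
allᵇ⁺ p (x ∷ xs) all = cong₂ _∧_ (all x (here refl)) (allᵇ⁺ p xs (λ y y∈ → all y (there y∈)))

allᵇ⁻ : ∀ {A : Set} (p : A → Bool) xs → allᵇ p xs ≡ true → ∀ {x} → x ∈ xs → p x ≡ true
allᵇ⁻ p (y ∷ xs) all (here refl) = ∧-conicalˡ (p y) _ all
allᵇ⁻ p (y ∷ xs) all (there x∈) = allᵇ⁻ p xs (∧-conicalʳ (p y) _ all) x∈

-- Counting and distinct values

count : {A : Set} → (A → Bool) → List A → ℕ
count p xs = length (filterᵇ p xs)

module _ {A : Set} where

  count-mono : (p q : A → Bool) (xs : List A) → (∀ x → p x ≡ true → q x ≡ true) →
               count p xs ≤ count q xs
  count-mono p q [] p⇒q = z≤n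
  count-mono p q (x ∷ xs) p⇒q with p x in px | q x in qx
  ... | true  | true  = s≤s (count-mono p q xs p⇒q)
  ... | true  | false with () ← trans (sym (p⇒q x px)) qx
  ... | false | true  = m≤n⇒m≤1+n (count-mono p q xs p⇒q)
  ... | false | false = count-mono p q xs p⇒q

  count-mono-< : (p q : A → Bool) (xs : List A) → (∀ x → p x ≡ true → q x ≡ true) →
                 ∀ {y} → y ∈ xs → q y ≡ true → p y ≡ false → count p xs < count q xs
  count-mono-< p q (x ∷ xs) p⇒q (here refl) qy py rewrite py | qy = s≤s (count-mono p q xs p⇒q)
  count-mono-< p q (x ∷ xs) p⇒q (there y∈xs) qy py with p x in px | q x in qx
  ... | true  | true  = s≤s (count-mono-< p q xs p⇒q y∈xs qy py)
  ... | true  | false with () ← trans (sym (p⇒q x px)) qx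
  ... | false | true  = m≤n⇒m≤1+n (count-mono-< p q xs p⇒q y∈xs qy py)
  ... | false | false = count-mono-< p q xs p⇒q y∈xs qy py

  count-≥⇒⊇ : (p q : A → Bool) (xs : List A) → (∀ x → p x ≡ true → q x ≡ true) →
              count q xs ≤ count p xs → ∀ {y} → y ∈ xs → q y ≡ true → p y ≡ true
  count-≥⇒⊇ p q xs p⇒q q≤p {y} y∈xs qy with p y in py
  ... | true  = refl
  ... | false = ⊥-elim (<⇒≱ (count-mono-< p q xs p⇒q y∈xs qy py) q≤p)

  count>0⇒∃ : (p : A → Bool) (xs : List A) → 1 ≤ count p xs → ∃ λ x → p x ≡ true
  count>0⇒∃ p (x ∷ xs) h with p x in px
  ... | true  = x , px
  ... | false = count>0⇒∃ p xs h

  ∃⇒count>0 : (p : A → Bool) (xs : List A) → ∀ {y} → y ∈ xs → p y ≡ true → 1 ≤ count p xs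
  ∃⇒count>0 p xs y∈xs py = ≤-trans (s≤s z≤n) (count-mono-< (λ _ → false) p xs (λ _ ()) y∈xs py refl)

  count-zero : (p : A → Bool) (xs : List A) → (∀ x → x ∈ xs → p x ≡ false) → count p xs ≡ 0
  count-zero p [] _ = refl
  count-zero p (x ∷ xs) none rewrite none x (here refl) = count-zero p xs (λ y y∈ → none y (there y∈))

  count-split : (p r : A → Bool) (xs : List A) →
                count p xs ≡ count (λ y → p y ∧ not (r y)) xs + count (λ y → p y ∧ r y) xs
  count-split p r [] = refl
  count-split p r (x ∷ xs) with p x | r x
  ... | false | _     = count-split p r xs
  ... | true  | false = cong suc (count-split p r xs)
  ... | true  | true  = trans (cong suc (count-split p r xs)) (sym (+-suc _ _))

module _ {A : Set} (_≟_ : DecidableEquality A) where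

  count-≟-∉ : (p : A → Bool) (xs : List A) → ∀ {a} → All (a ≢_) xs →
              count (λ y → p y ∧ does (y ≟ a)) xs ≡ 0
  count-≟-∉ p xs {a} a∉xs = count-zero _ xs λ y y∈xs →
    trans (cong (p y ∧_) (dec-false (y ≟ a) (λ y≡a → All.lookup a∉xs y∈xs (sym y≡a)))) (∧-zeroʳ (p y))

  count-≟ : (p : A → Bool) {xs : List A} → Unique xs → ∀ {a} → a ∈ xs →
            count (λ y → p y ∧ does (y ≟ a)) xs ≡ (if p a then 1 else 0)
  count-≟ p {x ∷ xs} (x∉xs ∷ _) (here refl) rewrite dec-true (x ≟ x) refl with p x
  ... | true  = cong suc (count-≟-∉ p xs x∉xs)
  ... | false = count-≟-∉ p xs x∉xs
  count-≟ p {x ∷ xs} (x∉xs ∷ unique) {a} (there a∈xs)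
    rewrite dec-false (x ≟ a) (λ { refl → All.lookup x∉xs a∈xs refl }) | ∧-zeroʳ (p x)
    = count-≟ p unique a∈xs

  count-except : (p : A → Bool) {xs : List A} → Unique xs → ∀ {a b} → a ∈ xs → b ∈ xs → p a ≡ p b →
                 count (λ y → p y ∧ not (does (y ≟ a))) xs ≡ count (λ y → p y ∧ not (does (y ≟ b))) xs
  count-except p {xs} unique {a} {b} a∈xs b∈xs pa≡pb = +-cancelʳ-≡ _ _ _ (begin
    count (λ y → p y ∧ not (does (y ≟ a))) xs + count (λ y → p y ∧ does (y ≟ a)) xs
      ≡⟨ sym (count-split p (λ y → does (y ≟ a)) xs) ⟩
    count p xs
      ≡⟨ count-split p (λ y → does (y ≟ b)) xs ⟩
    count (λ y → p y ∧ not (does (y ≟ b))) xs + count (λ y → p y ∧ does (y ≟ b)) xs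
      ≡⟨ cong (count (λ y → p y ∧ not (does (y ≟ b))) xs +_) (begin
           count (λ y → p y ∧ does (y ≟ b)) xs ≡⟨ count-≟ p unique b∈xs ⟩
           (if p b then 1 else 0)               ≡⟨ cong (λ c → if c then 1 else 0) (sym pa≡pb) ⟩
           (if p a then 1 else 0)               ≡⟨ sym (count-≟ p unique a∈xs) ⟩
           count (λ y → p y ∧ does (y ≟ a)) xs ∎) ⟩
    count (λ y → p y ∧ not (does (y ≟ b))) xs + count (λ y → p y ∧ does (y ≟ a)) xs ∎)
    where open ≡-Reasoning

  count≥2 : (p : A → Bool) {xs : List A} → ∀ {a b} → a ∈ xs → b ∈ xs → a ≢ b → p a ≡ true → p b ≡ true →
            2 ≤ count p xs
  count≥2 p {xs} {a} {b} a∈xs b∈xs a≢b pa pb = begin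
    2                   ≤⟨ s≤s (∃⇒count>0 p≢a xs b∈xs p≢a-b) ⟩
    suc (count p≢a xs)  ≤⟨ count-mono-< p≢a p xs (λ _ → proj₁ ∘ ∧-true⁻) a∈xs pa p≢a-a ⟩
    count p xs          ∎
    where
    open ≤-Reasoning
    p≢a : A → Bool
    p≢a y = p y ∧ not (does (y ≟ a))
    p≢a-b : p≢a b ≡ true
    p≢a-b rewrite pb | dec-false (b ≟ a) (a≢b ∘ sym) = refl
    p≢a-a : p≢a a ≡ false
    p≢a-a rewrite dec-true (a ≟ a) refl = ∧-zeroʳ (p a)

  ≢-does : ∀ {y a} → not (does (y ≟ a)) ≡ true → y ≢ a
  ≢-does {y} {a} h y≡a = true≢false (trans (sym h) (cong not (dec-true (y ≟ a) y≡a)))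

module _ {A : Set} where

  private
    remove : ∀ {y : A} (zs : List A) → y ∈ zs → List A
    remove (_ ∷ zs) (here _)     = zs
    remove (z ∷ zs) (there y∈zs) = z ∷ remove zs y∈zs

    length-remove : ∀ {y : A} (zs : List A) (y∈zs : y ∈ zs) → length zs ≡ suc (length (remove zs y∈zs))
    length-remove (_ ∷ zs) (here _)     = refl
    length-remove (z ∷ zs) (there y∈zs) = cong suc (length-remove zs y∈zs)

    ∈-remove : ∀ {x y : A} (zs : List A) (y∈zs : y ∈ zs) → x ∈ zs → x ≢ y → x ∈ remove zs y∈zs
    ∈-remove (_ ∷ zs) (here refl)  (here refl)  x≢y = ⊥-elim (x≢y refl)
    ∈-remove (_ ∷ zs) (here refl)  (there x∈zs) x≢y = x∈zs
    ∈-remove (z ∷ zs) (there y∈zs) (here x≡z)   x≢y = here x≡z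
    ∈-remove (z ∷ zs) (there y∈zs) (there x∈zs) x≢y = there (∈-remove zs y∈zs x∈zs x≢y)

  Unique⇒length-mono : ∀ {ys zs : List A} → Unique ys → ys ⊆ zs → length ys ≤ length zs
  Unique⇒length-mono {[]}     _                  _     = z≤n
  Unique⇒length-mono {y ∷ ys} {zs} (y∉ys ∷ unique) ys⊆zs = begin
    suc (length ys)                  ≤⟨ s≤s (Unique⇒length-mono unique ys⊆zs−y) ⟩
    suc (length (remove zs y∈zs))    ≡⟨ sym (length-remove zs y∈zs) ⟩
    length zs                        ∎
    where
    open ≤-Reasoning
    y∈zs : y ∈ zs
    y∈zs = ys⊆zs (here refl)
    ys⊆zs−y : ys ⊆ remove zs y∈zs
    ys⊆zs−y x∈ys = ∈-remove zs y∈zs (ys⊆zs (there x∈ys)) (λ x≡y → All.lookup y∉ys x∈ys (sym x≡y))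

card : List ℕ → ℕ
card xs = length (deduplicate ℕ._≟_ xs)

dedup⁺ : ∀ {xs z} → z ∈ xs → z ∈ deduplicate ℕ._≟_ xs
dedup⁺ = ∈-deduplicate⁺ ℕ._≟_

dedup⁻ : ∀ {xs z} → z ∈ deduplicate ℕ._≟_ xs → z ∈ xs
dedup⁻ {xs} = ∈-deduplicate⁻ ℕ._≟_ xs

card-mono : ∀ {xs ys} → xs ⊆ ys → card xs ≤ card ys
card-mono {xs} xs⊆ys = Unique⇒length-mono (deduplicate-! ℕ._≟_ xs) (dedup⁺ ∘ xs⊆ys ∘ dedup⁻)

card-mono-+ : ∀ {xs ys zs} → xs ⊆ ys → Unique zs → zs ⊆ ys → All (_∉ xs) zs →
              card xs + length zs ≤ card ys
card-mono-+ {xs} {ys} {zs} xs⊆ys unique-zs zs⊆ys zs∉xs = begin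
  card xs + length zs                  ≡⟨ sym (length-++ (deduplicate ℕ._≟_ xs)) ⟩
  length (deduplicate ℕ._≟_ xs ++ zs)  ≤⟨ Unique⇒length-mono unique ⊆ys ⟩
  card ys                              ∎
  where
  open ≤-Reasoning
  unique : Unique (deduplicate ℕ._≟_ xs ++ zs)
  unique = Unique.++⁺ (deduplicate-! ℕ._≟_ xs) unique-zs
             (λ (z∈xs , z∈zs) → All.lookup zs∉xs z∈zs (dedup⁻ z∈xs))
  ⊆ys : deduplicate ℕ._≟_ xs ++ zs ⊆ deduplicate ℕ._≟_ ys
  ⊆ys z∈ with ∈-++⁻ (deduplicate ℕ._≟_ xs) z∈
  ... | inj₁ z∈xs = dedup⁺ (xs⊆ys (dedup⁻ z∈xs))
  ... | inj₂ z∈zs = dedup⁺ (zs⊆ys z∈zs)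

card-∷ : ∀ x xs → card (x ∷ xs) ≤ suc (card xs)
card-∷ x xs = Unique⇒length-mono {zs = x ∷ deduplicate ℕ._≟_ xs} (deduplicate-! ℕ._≟_ (x ∷ xs)) λ z∈ →
  case dedup⁻ {x ∷ xs} z∈ of λ where
  (here z≡x)    → here z≡x
  (there z∈xs) → there (dedup⁺ z∈xs)

module _ {V : Set} (α β : V → ℕ) (refines : ∀ {v w} → β v ≡ β w → α v ≡ α w) where

  card-refine : ∀ T → card (map α T) ≤ card (map β T)
  card-refine []      = z≤n
  card-refine (t ∷ T) with α t ∈? map α T
  ... | yes αt∈ = begin
    card (α t ∷ map α T)  ≤⟨ card-mono (λ { (here refl) → αt∈ ; (there αv∈) → αv∈ }) ⟩
    card (map α T)        ≤⟨ card-refine T ⟩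
    card (map β T)        ≤⟨ card-mono {ys = β t ∷ map β T} there ⟩
    card (β t ∷ map β T)  ∎
    where open ≤-Reasoning
  ... | no αt∉ = begin
    card (α t ∷ map α T)  ≤⟨ card-∷ (α t) (map α T) ⟩
    suc (card (map α T))  ≤⟨ s≤s (card-refine T) ⟩
    suc (card (map β T))  ≡⟨ +-comm 1 _ ⟩
    card (map β T) + 1    ≤⟨ card-mono-+ there ([] ∷ []) (λ { (here refl) → here refl }) (βt∉ ∷ []) ⟩
    card (β t ∷ map β T)  ∎
    where
    open ≤-Reasoning
    βt∉ : β t ∉ map β T
    βt∉ βt∈ with ∈-map⁻ β βt∈
    ... | t′ , t′∈T , βt≡βt′ = αt∉ (subst (_∈ map α T) (sym (refines βt≡βt′)) (∈-map⁺ α t′∈T))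

  private
    module WithoutClass (T : List V) (b : ℕ) where

      T′ : List V
      T′ = filter (λ v → ¬? (β v ℕ.≟ b)) T

      ∈T′ : ∀ {v} → v ∈ T → β v ≢ b → v ∈ T′
      ∈T′ = ∈-filter⁺ (λ v → ¬? (β v ℕ.≟ b))

      card-β : ∀ {q} → q ∈ T → β q ≡ b → card (map β T′) + 1 ≤ card (map β T)
      card-β q∈T refl = card-mono-+ T′⊆T ([] ∷ []) (λ { (here refl) → ∈-map⁺ β q∈T }) (b∉ ∷ [])
        where
        T′⊆T : map β T′ ⊆ map β T
        T′⊆T βv∈ with ∈-map⁻ β βv∈
        ... | v , v∈T′ , refl = ∈-map⁺ β (proj₁ (∈-filter⁻ (λ v → ¬? (β v ℕ.≟ b)) {xs = T} v∈T′))
        b∉ : b ∉ map β T′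
        b∉ b∈ with ∈-map⁻ β b∈
        ... | v , v∈T′ , b≡βv = proj₂ (∈-filter⁻ (λ v → ¬? (β v ℕ.≟ b)) {xs = T} v∈T′) (sym b≡βv)

      -- The α-class of the removed β-class survives through p.
      card-α : ∀ {p} → p ∈ T → β p ≢ b → (∀ {t} → β t ≡ b → α t ≡ α p) →
               card (map α T) ≤ card (map α T′)
      card-α {p} p∈T βp≢b class-α = card-mono λ αt∈ → case ∈-map⁻ α αt∈ of λ where
        (t , t∈T , refl) → case β t ℕ.≟ b of λ where
          (yes βt≡b) → subst (_∈ map α T′) (sym (class-α βt≡b)) (∈-map⁺ α (∈T′ p∈T βp≢b))
          (no βt≢b)  → ∈-map⁺ α (∈T′ t∈T βt≢b)

  card-split : ∀ T {p q} → p ∈ T → q ∈ T → α p ≡ α q → β p ≢ β q →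
               card (map α T) + 1 ≤ card (map β T)
  card-split T {p} {q} p∈T q∈T αp≡αq βp≢βq = begin
    card (map α T) + 1   ≤⟨ +-monoˡ-≤ 1 (card-α p∈T βp≢βq (λ βt≡βq → trans (refines βt≡βq) (sym αp≡αq))) ⟩
    card (map α T′) + 1  ≤⟨ +-monoˡ-≤ 1 (card-refine T′) ⟩
    card (map β T′) + 1  ≤⟨ card-β q∈T refl ⟩
    card (map β T)       ∎
    where
    open ≤-Reasoning
    open WithoutClass T (β q)

  card-split² : ∀ T {p q p₂ q₂} → p ∈ T → q ∈ T → α p ≡ α q → β p ≢ β q →
                p₂ ∈ T → q₂ ∈ T → α p₂ ≡ α q₂ → β p₂ ≢ β q₂ → β p₂ ≢ β q → β q₂ ≢ β q →
                card (map α T) + 2 ≤ card (map β T)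
  card-split² T {p} {q} p∈T q∈T αp≡αq βp≢βq p₂∈T q₂∈T αp₂≡αq₂ βp₂≢βq₂ βp₂≢βq βq₂≢βq = begin
    card (map α T) + 2       ≤⟨ +-monoˡ-≤ 2 (card-α p∈T βp≢βq (λ βt≡βq → trans (refines βt≡βq) (sym αp≡αq))) ⟩
    card (map α T′) + 2      ≡⟨ sym (+-assoc _ 1 1) ⟩
    card (map α T′) + 1 + 1  ≤⟨ +-monoˡ-≤ 1 split₂ ⟩
    card (map β T′) + 1      ≤⟨ card-β q∈T refl ⟩
    card (map β T)           ∎
    where
    open ≤-Reasoning
    open WithoutClass T (β q)
    split₂ : card (map α T′) + 1 ≤ card (map β T′)
    split₂ = card-split T′ (∈T′ p₂∈T βp₂≢βq) (∈T′ q₂∈T βq₂≢βq) αp₂≡αq₂ βp₂≢βq₂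

-- Graphs and colour refinement

adj⇒≢ : ∀ {n} (G : Graph n) {v y} → adj G v y ≡ true → v ≢ y
adj⇒≢ G {v} v~y refl with () ← trans (sym v~y) (Graph.irrefl G v)

walk-closed : ∀ {n} {G : Graph n} (P : Fin n → Set) → (∀ {x y} → P x → adj G x y ≡ true → P y) →
              ∀ {x y} → Walk G x y → P x → P y
walk-closed P closed here       px = px
walk-closed P closed (step a w) px = walk-closed P closed w (closed px a)

module _ {n : ℕ} (G : Graph n) where

  hasNeighbour : (Fin n → Bool) → Fin n → Bool
  hasNeighbour P v = not (nbCount G v P ≡ᵇ 0)

  private
    ≥1⇒≢ᵇ0 : ∀ {m} → 1 ≤ m → not (m ≡ᵇ 0) ≡ true
    ≥1⇒≢ᵇ0 (s≤s _) = refl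

    ≢ᵇ0⇒≥1 : ∀ {m} → not (m ≡ᵇ 0) ≡ true → 1 ≤ m
    ≢ᵇ0⇒≥1 {suc m} _ = s≤s z≤n

  hasNeighbour⁺ : ∀ P {v y} → adj G v y ≡ true → P y ≡ true → hasNeighbour P v ≡ true
  hasNeighbour⁺ P {v} v~y py =
    ≥1⇒≢ᵇ0 (∃⇒count>0 (λ y → adj G v y ∧ P y) (allFin n) (∈-allFin _) (cong₂ _∧_ v~y py))

  hasNeighbour⁻ : ∀ P {v} → hasNeighbour P v ≡ true → ∃ λ y → adj G v y ≡ true × P y ≡ true
  hasNeighbour⁻ P {v} h with count>0⇒∃ (λ y → adj G v y ∧ P y) (allFin n) (≢ᵇ0⇒≥1 h)
  ... | y , v~y∧py = y , ∧-true⁻ v~y∧py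

module WLRounds {n : ℕ} (G : Graph n) (c : Coloring n) where

  private
    W : ℕ → Fin n → Fin n → Bool
    W = wlEq G c

  W-count : ∀ k v w → W (suc k) v w ≡ true → ∀ x →
            nbCount G v (λ y → W k y x) ≡ nbCount G w (λ y → W k y x)
  W-count k v w e x = ≡ᵇ-true⇒≡ _ _ (allᵇ⁻ _ (allFin n) (∧-conicalʳ (W k v w) _ e) (∈-allFin x))

  W-intro : ∀ k v w → W k v w ≡ true →
            (∀ x → nbCount G v (λ y → W k y x) ≡ nbCount G w (λ y → W k y x)) → W (suc k) v w ≡ true
  W-intro k v w e counts = cong₂ _∧_ e (allᵇ⁺ _ (allFin n) (λ x _ → ≡⇒≡ᵇ-true _ _ (counts x)))

  W-weaken : ∀ {j} k v w → j ≤ k → W k v w ≡ true → W j v w ≡ true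
  W-weaken zero    v w z≤n e = e
  W-weaken (suc k) v w j≤k e with m≤n⇒m<n∨m≡n j≤k
  ... | inj₂ refl        = e
  ... | inj₁ (s≤s j≤k′) = W-weaken k v w j≤k′ (∧-conicalˡ (W k v w) _ e)

  W-refl : ∀ k v → W k v v ≡ true
  W-refl zero    v = ≡⇒≡ᵇ-true (c v) (c v) refl
  W-refl (suc k) v = W-intro k v v (W-refl k v) (λ _ → refl)

  W-sym : ∀ k v w → W k v w ≡ true → W k w v ≡ true
  W-sym zero    v w e = ≡⇒≡ᵇ-true (c w) (c v) (sym (≡ᵇ-true⇒≡ (c v) (c w) e))
  W-sym (suc k) v w e =
    W-intro k w v (W-sym k v w (∧-conicalˡ (W k v w) _ e)) (λ x → sym (W-count k v w e x))

  W-trans : ∀ k v w z → W k v w ≡ true → W k w z ≡ true → W k v z ≡ true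
  W-trans zero    v w z e e′ =
    ≡⇒≡ᵇ-true (c v) (c z) (trans (≡ᵇ-true⇒≡ (c v) (c w) e) (≡ᵇ-true⇒≡ (c w) (c z) e′))
  W-trans (suc k) v w z e e′ =
    W-intro k v z (W-trans k v w z (∧-conicalˡ (W k v w) _ e) (∧-conicalˡ (W k w z) _ e′))
                  (λ x → trans (W-count k v w e x) (W-count k w z e′ x))

  -- WL1 names a class by the position of its first member, so equal names share a member.
  WL1⇒W : ∀ v w → WL1 G c v ≡ WL1 G c w → W n v w ≡ true
  WL1⇒W v w e = let x , xv , xw = common (allFin n) (∈-allFin v) e in W-trans n v x w (W-sym n x v xv) xw
    where
    position : Fin n → List (Fin n) → ℕ
    position v xs = length (takeWhileᵇ (λ x → not (W n x v)) xs)
    common : ∀ xs → v ∈ xs → position v xs ≡ position w xs → ∃ λ x → W n x v ≡ true × W n x w ≡ true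
    common (x ∷ xs) v∈ e with W n x v in xv | W n x w in xw
    ... | true  | true  = x , xv , xw
    common (x ∷ xs) (here refl) e | false | false with () ← trans (sym xv) (W-refl n v)
    common (x ∷ xs) (there v∈)  e | false | false = common xs v∈ (suc-injective e)

  W-hasNeighbour : ∀ k P → (∀ x y → W k x y ≡ true → P x ≡ P y) →
                   ∀ v w → W (suc k) v w ≡ true → hasNeighbour G P v ≡ hasNeighbour G P w
  W-hasNeighbour k P resp v w e = bool-ext (transfer v w e) (transfer w v (W-sym (suc k) v w e))
    where
    transfer : ∀ v w → W (suc k) v w ≡ true → hasNeighbour G P v ≡ true → hasNeighbour G P w ≡ true
    transfer v w e h with hasNeighbour⁻ G P h
    ... | y , v~y , py
      with hasNeighbour⁻ G (λ y′ → W k y′ y) (subst (λ m → not (m ≡ᵇ 0) ≡ true) (W-count k v w e y)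
                                                  (hasNeighbour⁺ G (λ y′ → W k y′ y) v~y (W-refl k y)))
    ...   | y′ , w~y′ , y′≈y = hasNeighbour⁺ G P w~y′ (trans (resp y′ y y′≈y) py)

module Individualised {n : ℕ} (G : Graph n) (χ : Coloring n) (u : Fin n) where

  open WLRounds G (individualize χ u)

  χ′ : Coloring n
  χ′ = WL1 G (individualize χ u)

  -- layer j v holds iff some walk of length exactly j leads from u to v.
  layer : ℕ → Fin n → Bool
  layer zero    v = does (v ≟ u)
  layer (suc j)   = hasNeighbour G (layer j)

  private
    W₀-individualize : ∀ v w → wlEq G (individualize χ u) 0 v w ≡ true →
                       layer 0 v ≡ layer 0 w × χ v ≡ χ w
    W₀-individualize v w e with v ≟ u | w ≟ u
    ... | yes refl | yes refl = refl , refl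
    ... | no _     | no _     = refl , suc-injective (≡ᵇ-true⇒≡ (suc (χ v)) (suc (χ w)) e)

    W-layer : ∀ j v w → wlEq G (individualize χ u) j v w ≡ true → layer j v ≡ layer j w
    W-layer zero    v w e = proj₁ (W₀-individualize v w e)
    W-layer (suc j) v w e = W-hasNeighbour j (layer j) (W-layer j) v w e

    χ′⇒W : ∀ {j} v w → j ≤ n → χ′ v ≡ χ′ w → wlEq G (individualize χ u) j v w ≡ true
    χ′⇒W v w j≤n e = W-weaken n v w j≤n (WL1⇒W v w e)

  χ′-layer : ∀ j v w → j ≤ n → χ′ v ≡ χ′ w → layer j v ≡ layer j w
  χ′-layer j v w j≤n e = W-layer j v w (χ′⇒W v w j≤n e)

  χ′⇒χ : ∀ v w → χ′ v ≡ χ′ w → χ v ≡ χ w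
  χ′⇒χ v w e = proj₂ (W₀-individualize v w (χ′⇒W v w z≤n e))

  χ′-singleton : ∀ v → χ′ u ≡ χ′ v → u ≡ v
  χ′-singleton v e with v ≟ u | χ′-layer 0 u v z≤n e
  ... | yes v≡u | _ = sym v≡u
  ... | no _    | layer₀ rewrite dec-true (u ≟ u) refl with () ← layer₀

  layer₁ : ∀ v → layer 1 v ≡ adj G u v
  layer₁ v = bool-ext from to
    where
    from : layer 1 v ≡ true → adj G u v ≡ true
    from h with hasNeighbour⁻ G (layer 0) h
    ... | y , v~y , y≟u with y ≟ u
    ...   | yes refl = trans (Graph.sym G u v) v~y
    to : adj G u v ≡ true → layer 1 v ≡ true
    to u~v = hasNeighbour⁺ G (layer 0) (trans (Graph.sym G v u) u~v) (dec-true (u ≟ u) refl)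

  χ′-adj : ∀ v w → χ′ v ≡ χ′ w → adj G u v ≡ adj G u w
  χ′-adj v w e = trans (sym (layer₁ v)) (trans (χ′-layer 1 v w (1≤n u) e) (layer₁ w))
    where
    1≤n : ∀ {m} → Fin m → 1 ≤ m
    1≤n {suc m} _ = s≤s z≤n

  private
    ball : ℕ → Fin n → Bool
    ball zero      = layer 0
    ball (suc j) v = ball j v ∨ hasNeighbour G (ball j) v

    ball⇒layer : ∀ j v → ball j v ≡ true → ∃ λ i → i ≤ j × layer i v ≡ true
    ball⇒layer zero    v h = 0 , z≤n , h
    ball⇒layer (suc j) v h with ball j v in e
    ... | true  = let i , i≤j , l = ball⇒layer j v e in i , m≤n⇒m≤1+n i≤j , l
    ... | false = let y , v~y , y∈ = hasNeighbour⁻ G (ball j) h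
                      i , i≤j , l = ball⇒layer j y y∈
                  in suc i , s≤s i≤j , hasNeighbour⁺ G (layer i) v~y l

    ball-mono : ∀ j v → ball j v ≡ true → ball (suc j) v ≡ true
    ball-mono j v h = cong (_∨ hasNeighbour G (ball j) v) h

    ball-u : ∀ j → ball j u ≡ true
    ball-u zero    = dec-true (u ≟ u) refl
    ball-u (suc j) = ball-mono j u (ball-u j)

    -- A ball that stops growing is closed under adjacency, so by connectivity it is everything.
    ball-grows : Connected G → ∀ j → (∀ v → ball j v ≡ true) ⊎ (j < count (ball j) (allFin n))
    ball-grows conn zero = inj₂ (∃⇒count>0 (ball 0) (allFin n) (∈-allFin u) (ball-u 0))
    ball-grows conn (suc j) with ball-grows conn j
    ... | inj₁ all = inj₁ (λ v → ball-mono j v (all v))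
    ... | inj₂ j<count with any? (λ v → (ball (suc j) v Bool.≟ true) ×-dec (ball j v Bool.≟ false))
    ...   | yes (v , new , old) = inj₂ (≤-trans (s≤s j<count)
              (count-mono-< (ball j) (ball (suc j)) (allFin n) (ball-mono j) (∈-allFin v) new old))
    ...   | no stuck = inj₁ λ v →
              ball-mono j v (walk-closed (λ x → ball j x ≡ true) closed (conn u v) (ball-u j))
      where
      closed : ∀ {x y} → ball j x ≡ true → adj G x y ≡ true → ball j y ≡ true
      closed {x} {y} bx x~y with ball j y in by
      ... | true  = refl
      ... | false = ⊥-elim (stuck (y , new , by))
        where
        new : ball (suc j) y ≡ true
        new = trans (cong (_∨ hasNeighbour G (ball j) y) by)
                    (hasNeighbour⁺ G (ball j) (trans (Graph.sym G y x) x~y) bx)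

  reachable : Connected G → ∀ v → ∃ λ j → j ≤ n × layer j v ≡ true
  reachable conn v with ball-grows conn n
  ... | inj₁ all = ball⇒layer n v (all v)
  ... | inj₂ n<count = ⊥-elim (<⇒≱ n<count (subst (count (ball n) (allFin n) ≤_) (length-tabulate (λ x → x))
                                                   (length-filter _ (allFin n))))

-- Colours inside and outside S

module _ {n : ℕ} where

  vertices : VSet n → List (Fin n)
  vertices X = filterᵇ X (allFin n)

  ∈-vertices⁺ : ∀ {X v} → X v ≡ true → v ∈ vertices X
  ∈-vertices⁺ {X} {v} Xv = ∈-filter⁺ (Bool.T? ∘ X) (∈-allFin v) (Equivalence.from T-≡ Xv)

  ∈-vertices⁻ : ∀ {X v} → v ∈ vertices X → X v ≡ true
  ∈-vertices⁻ {X} v∈ = Equivalence.to T-≡ (proj₂ (∈-filter⁻ (Bool.T? ∘ X) {xs = allFin n} v∈))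

  ∈-image⁺ : ∀ (γ : Coloring n) X {v} → X v ≡ true → γ v ∈ image γ X
  ∈-image⁺ γ X Xv = dedup⁺ (∈-map⁺ γ (∈-vertices⁺ Xv))

  ∈-image⁻ : ∀ (γ : Coloring n) X {c} → c ∈ image γ X → ∃ λ v → X v ≡ true × c ≡ γ v
  ∈-image⁻ γ X c∈ with ∈-map⁻ γ (dedup⁻ c∈)
  ... | v , v∈ , c≡γv = v , ∈-vertices⁻ v∈ , c≡γv

module ExclusiveColours {n : ℕ} (S : VSet n) where

  Exclusive : Coloring n → Fin n → Set
  Exclusive γ v = S v ≡ true × γ v ∉ image γ (complement S)

  exclusive? : ∀ γ v → Dec (Exclusive γ v)
  exclusive? γ v = (S v Bool.≟ true) ×-dec ¬? (γ v ∈? image γ (complement S))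

  exclusiveVertices : Coloring n → List (Fin n)
  exclusiveVertices γ = filter (exclusive? γ) (allFin n)

  ∈-exclusiveVertices⁺ : ∀ {γ v} → Exclusive γ v → v ∈ exclusiveVertices γ
  ∈-exclusiveVertices⁺ {γ} {v} = ∈-filter⁺ (exclusive? γ) (∈-allFin v)

  ∈-exclusiveVertices⁻ : ∀ {γ v} → v ∈ exclusiveVertices γ → Exclusive γ v
  ∈-exclusiveVertices⁻ {γ} v∈ = proj₂ (∈-filter⁻ (exclusive? γ) {xs = allFin n} v∈)

  exclusive⁺ : ∀ {γ v} → (∀ w → γ w ≡ γ v → S w ≡ true) → Exclusive γ v
  exclusive⁺ {γ} {v} class⊆S = class⊆S v refl , γv∉
    where
    γv∉ : γ v ∉ image γ (complement S)
    γv∉ γv∈ with ∈-image⁻ γ (complement S) γv∈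
    ... | w , Iw , γv≡γw = true≢false (trans (sym (class⊆S w (sym γv≡γw))) (not-true Iw))

  exclusive-colour : ∀ {γ v w} → Exclusive γ v → S w ≡ true → γ v ≡ γ w → Exclusive γ w
  exclusive-colour {γ} (_ , γv∉) Sw γv≡γw = Sw , subst (_∉ image γ (complement S)) γv≡γw γv∉

  ∣img-diff∣≡card : ∀ γ → ∣img-diff∣ γ S (complement S) ≡ card (map γ (exclusiveVertices γ))
  ∣img-diff∣≡card γ =
    ≤-antisym (Unique⇒length-mono unique-diff diff⊆) (Unique⇒length-mono (deduplicate-! ℕ._≟_ _) ⊆diff)
    where
    outside? : ∀ c → Dec (c ∉ image γ (complement S))
    outside? c = ¬? (c ∈? image γ (complement S))
    diff : List ℕ
    diff = filter outside? (image γ S)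
    unique-diff : Unique diff
    unique-diff = Unique.filter⁺ outside? (deduplicate-! ℕ._≟_ (map γ (vertices S)))
    diff⊆ : diff ⊆ deduplicate ℕ._≟_ (map γ (exclusiveVertices γ))
    diff⊆ c∈ with ∈-filter⁻ outside? {xs = image γ S} c∈
    ... | c∈S , c∉I with ∈-image⁻ γ S c∈S
    ...   | v , Sv , refl = dedup⁺ (∈-map⁺ γ (∈-exclusiveVertices⁺ (Sv , c∉I)))
    ⊆diff : deduplicate ℕ._≟_ (map γ (exclusiveVertices γ)) ⊆ diff
    ⊆diff c∈ with ∈-map⁻ γ (dedup⁻ c∈)
    ... | v , v∈ , refl with ∈-exclusiveVertices⁻ v∈
    ...   | Sv , γv∉ = ∈-filter⁺ outside? (∈-image⁺ γ S Sv) γv∉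

module RefinedColouring {n : ℕ} (S : VSet n) (χ χ′ : Coloring n)
                        (refines : ∀ v w → χ′ v ≡ χ′ w → χ v ≡ χ w) where

  open ExclusiveColours S

  img-split : ∀ {p q} → S p ≡ true → S q ≡ true → χ p ≡ χ q → χ′ p ≢ χ′ q →
              ∣img∣ χ S + 1 ≤ ∣img∣ χ′ S
  img-split Sp Sq = card-split χ χ′ (refines _ _) (vertices S) (∈-vertices⁺ Sp) (∈-vertices⁺ Sq)

  img-split² : ∀ {p q p₂ q₂} → S p ≡ true → S q ≡ true → χ p ≡ χ q → χ′ p ≢ χ′ q →
               S p₂ ≡ true → S q₂ ≡ true → χ p₂ ≡ χ q₂ → χ′ p₂ ≢ χ′ q₂ →
               χ′ p₂ ≢ χ′ q → χ′ q₂ ≢ χ′ q →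
               ∣img∣ χ S + 2 ≤ ∣img∣ χ′ S
  img-split² Sp Sq χp≡χq χ′p≢χ′q Sp₂ Sq₂ =
    card-split² χ χ′ (refines _ _) (vertices S) (∈-vertices⁺ Sp) (∈-vertices⁺ Sq) χp≡χq χ′p≢χ′q
                                               (∈-vertices⁺ Sp₂) (∈-vertices⁺ Sq₂)

  NewlyExclusive : Fin n → Set
  NewlyExclusive p = Exclusive χ′ p × ∃ λ i → S i ≡ false × χ i ≡ χ p

  private
    E E′ : List (Fin n)
    E  = exclusiveVertices χ
    E′ = exclusiveVertices χ′

    exclusive-refine : ∀ {v} → Exclusive χ v → Exclusive χ′ v
    exclusive-refine {v} (Sv , χv∉) = Sv , λ χ′v∈ → case ∈-image⁻ χ′ (complement S) χ′v∈ of λ where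
      (w , Iw , χ′v≡χ′w) →
        χv∉ (subst (_∈ image χ (complement S)) (sym (refines v w χ′v≡χ′w)) (∈-image⁺ χ _ Iw))

    E⊆E′ : map χ′ E ⊆ map χ′ E′
    E⊆E′ c∈ with ∈-map⁻ χ′ c∈
    ... | v , v∈E , refl = ∈-map⁺ χ′ (∈-exclusiveVertices⁺ (exclusive-refine (∈-exclusiveVertices⁻ v∈E)))

    new∈ : ∀ {p} → NewlyExclusive p → χ′ p ∈ map χ′ E′
    new∈ (excl , _) = ∈-map⁺ χ′ (∈-exclusiveVertices⁺ excl)

    new∉ : ∀ {p} → NewlyExclusive p → χ′ p ∉ map χ′ E
    new∉ {p} (_ , i , Si , χi≡χp) c∈ with ∈-map⁻ χ′ c∈
    ... | v , v∈E , χ′p≡χ′v = proj₂ (∈-exclusiveVertices⁻ v∈E)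
      (subst (_∈ image χ (complement S)) (trans χi≡χp (refines p v χ′p≡χ′v)) (∈-image⁺ χ _ (cong not Si)))

  diff-new : ∀ ps → All NewlyExclusive ps → Unique (map χ′ ps) →
             ∣img-diff∣ χ S (complement S) + length ps ≤ ∣img-diff∣ χ′ S (complement S)
  diff-new ps new unique = begin
    ∣img-diff∣ χ S (complement S) + length ps     ≡⟨ cong₂ _+_ (∣img-diff∣≡card χ) (sym (length-map χ′ ps)) ⟩
    card (map χ E) + length (map χ′ ps)         ≤⟨ +-monoˡ-≤ _ (card-refine χ χ′ (refines _ _) E) ⟩
    card (map χ′ E) + length (map χ′ ps)        ≤⟨ card-mono-+ E⊆E′ unique ps⊆E′ ps∉E ⟩
    card (map χ′ E′)                            ≡⟨ sym (∣img-diff∣≡card χ′) ⟩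
    ∣img-diff∣ χ′ S (complement S)              ∎
    where
    open ≤-Reasoning
    ps⊆E′ : map χ′ ps ⊆ map χ′ E′
    ps⊆E′ c∈ with ∈-map⁻ χ′ c∈
    ... | p , p∈ps , refl = new∈ (All.lookup new p∈ps)
    ps∉E : All (_∉ map χ′ E) (map χ′ ps)
    ps∉E = All-map⁺ (All.map new∉ new)

  diff-split-new : ∀ {p a b} → NewlyExclusive p → Exclusive χ a → S b ≡ true → χ a ≡ χ b → χ′ a ≢ χ′ b →
                   ∣img-diff∣ χ S (complement S) + 2 ≤ ∣img-diff∣ χ′ S (complement S)
  diff-split-new {p} {a} {b} new excl-a Sb χa≡χb χ′a≢χ′b = begin
    ∣img-diff∣ χ S (complement S) + 2  ≡⟨ cong (_+ 2) (∣img-diff∣≡card χ) ⟩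
    card (map χ E) + 2                 ≡⟨ sym (+-assoc _ 1 1) ⟩
    card (map χ E) + 1 + 1             ≤⟨ +-monoˡ-≤ 1 (card-split χ χ′ (refines _ _) E a∈E b∈E χa≡χb χ′a≢χ′b) ⟩
    card (map χ′ E) + 1                ≤⟨ card-mono-+ E⊆E′ ([] ∷ []) (λ { (here refl) → new∈ new }) (new∉ new ∷ []) ⟩
    card (map χ′ E′)                   ≡⟨ sym (∣img-diff∣≡card χ′) ⟩
    ∣img-diff∣ χ′ S (complement S)     ∎
    where
    open ≤-Reasoning
    a∈E : a ∈ E
    a∈E = ∈-exclusiveVertices⁺ excl-a
    b∈E : b ∈ E
    b∈E = ∈-exclusiveVertices⁺ (exclusive-colour excl-a Sb χa≡χb)

-- Stable colourings and vertex covers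

module StableColouring {n : ℕ} (G : Graph n) (χ : Coloring n) (stable : Stable G χ) where

  private
    nbhd : Fin n → ℕ → Fin n → Bool
    nbhd v c y = adj G v y ∧ (χ y ≡ᵇ c)

  twin-neighbour : ∀ {v w y} → χ v ≡ χ w → adj G v y ≡ true → ∃ λ y′ → adj G w y′ ≡ true × χ y′ ≡ χ y
  twin-neighbour {v} {w} {y} χv≡χw v~y
    with hasNeighbour⁻ G P (subst (λ m → not (m ≡ᵇ 0) ≡ true) (stable v w χv≡χw (χ y))
                               (hasNeighbour⁺ G P v~y (≡⇒≡ᵇ-true (χ y) (χ y) refl)))
    where
    P : Fin n → Bool
    P z = χ z ≡ᵇ χ y
  ... | y′ , w~y′ , χy′≡ᵇχy = y′ , w~y′ , ≡ᵇ-true⇒≡ (χ y′) (χ y) χy′≡ᵇχy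

  -- Equally coloured vertices have equally many c-coloured neighbours, so an inclusion is an equality.
  neighbourhood-⊆⇒⊇ : ∀ {x v} c → χ x ≡ χ v →
                      (∀ y → χ y ≡ c → adj G x y ≡ true → adj G v y ≡ true) →
                      ∀ y → χ y ≡ c → adj G v y ≡ true → adj G x y ≡ true
  neighbourhood-⊆⇒⊇ {x} {v} c χx≡χv x⊆v y χy≡c v~y =
    proj₁ (∧-true⁻ (count-≥⇒⊇ (nbhd x c) (nbhd v c) (allFin n) x⇒v (≤-reflexive (stable v x (sym χx≡χv) c))
                                (∈-allFin y) (cong₂ _∧_ v~y (≡⇒≡ᵇ-true (χ y) c χy≡c))))
    where
    x⇒v : ∀ y → nbhd x c y ≡ true → nbhd v c y ≡ true
    x⇒v y h = let x~y , χy≡ᵇc = ∧-true⁻ h in cong₂ _∧_ (x⊆v y (≡ᵇ-true⇒≡ (χ y) c χy≡ᵇc) x~y) χy≡ᵇc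

  -- u's neighbours of colour d are that class minus u; v has as many, all in the class minus v.
  complete-colour : ∀ {u v} d → χ v ≡ χ u → (∀ x → χ x ≡ d → x ≢ u → adj G u x ≡ true) →
                    ∀ x → χ x ≡ d → x ≢ v → adj G v x ≡ true
  complete-colour {u} {v} d χv≡χu u-sees x χx≡d x≢v =
    proj₁ (∧-true⁻ (count-≥⇒⊇ (nbhd v d) (class-except v) (allFin n) nbhd⇒class class≤nbhd
                                (∈-allFin x) (cong₂ _∧_ (≡⇒≡ᵇ-true (χ x) d χx≡d) (cong not (dec-false (x ≟ v) x≢v)))))
    where
    open ≤-Reasoning
    class-except : Fin n → Fin n → Bool
    class-except a y = (χ y ≡ᵇ d) ∧ not (does (y ≟ a))
    nbhd⇒class : ∀ y → nbhd v d y ≡ true → class-except v y ≡ true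
    nbhd⇒class y h = let v~y , χy≡ᵇd = ∧-true⁻ h in
      cong₂ _∧_ χy≡ᵇd (cong not (dec-false (y ≟ v) (λ y≡v → adj⇒≢ G v~y (sym y≡v))))
    class⇒nbhd-u : ∀ y → class-except u y ≡ true → nbhd u d y ≡ true
    class⇒nbhd-u y h = let χy≡ᵇd , y≢u = ∧-true⁻ h in
      cong₂ _∧_ (u-sees y (≡ᵇ-true⇒≡ (χ y) d χy≡ᵇd) (≢-does _≟_ y≢u)) χy≡ᵇd
    class≤nbhd : count (class-except v) (allFin n) ≤ count (nbhd v d) (allFin n)
    class≤nbhd = begin
      count (class-except v) (allFin n) ≡⟨ count-except _≟_ (λ y → χ y ≡ᵇ d) (Unique.allFin⁺ n) (∈-allFin v) (∈-allFin u)
                                             (cong (_≡ᵇ d) χv≡χu) ⟩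
      count (class-except u) (allFin n) ≤⟨ count-mono _ _ (allFin n) class⇒nbhd-u ⟩
      count (nbhd u d) (allFin n)       ≡⟨ stable u v (sym χv≡χu) d ⟩
      count (nbhd v d) (allFin n)       ∎

module CoveredStableGraph {n : ℕ} (G : Graph n) (χ : Coloring n) (stable : Stable G χ)
                          (S : VSet n) (cover : VertexCover G S) where

  open StableColouring G χ stable
  open ExclusiveColours S

  CompletePair : Set
  CompletePair = Σ ℕ λ c → Σ ℕ λ d →
    (∃ λ v → χ v ≡ c) × (∃ λ w → χ w ≡ d) × 2 ≤ ∣preimage2∣ χ c d ×
    (∀ v w → χ v ≡ c → χ w ≡ d → ¬ v ≡ w → adj G v w ≡ true)

  Separated : Fin n → Set
  Separated u = let χ′ = WL1 G (individualize χ u) in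
    ∀ v w → S v ≡ true → complement S w ≡ true → ¬ χ′ v ≡ χ′ w

  Progress : Fin n → Set
  Progress u = let χ′ = WL1 G (individualize χ u) ; I = complement S in
    ((∣img∣ χ S + 2 ≤ ∣img∣ χ′ S) × (∣img-diff∣ χ S I + 1 ≤ ∣img-diff∣ χ′ S I))
    ⊎ ((∣img∣ χ S + 1 ≤ ∣img∣ χ′ S) × (∣img-diff∣ χ S I + 2 ≤ ∣img-diff∣ χ′ S I))
    ⊎ Separated u

  covered : ∀ {x y} → S x ≡ false → adj G x y ≡ true → S y ≡ true
  covered {x} {y} Sx x~y with cover x y x~y
  ... | inj₁ Sx′ with () ← trans (sym Sx′) Sx
  ... | inj₂ Sy  = Sy

  neighbours-in-S : ∀ {x v} c → S x ≡ false → χ x ≡ χ v →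
                    (∀ y → S y ≡ true → χ y ≡ c → adj G x y ≡ true → adj G v y ≡ true) →
                    ∀ y → χ y ≡ c → adj G v y ≡ true → S y ≡ true
  neighbours-in-S c Sx χx≡χv x⊆v y χy≡c v~y = covered Sx (neighbourhood-⊆⇒⊇ c χx≡χv x⊆v′ y χy≡c v~y)
    where
    x⊆v′ : ∀ y → χ y ≡ c → adj G _ y ≡ true → adj G _ y ≡ true
    x⊆v′ y χy≡c x~y = x⊆v y (covered Sx x~y) χy≡c x~y

  unmixed-separated : (∀ v w → S v ≡ true → S w ≡ false → χ v ≢ χ w) → ∀ u → Separated u
  unmixed-separated unmixed u v w Sv Iw χ′v≡χ′w =
    unmixed v w Sv (not-true Iw) (Individualised.χ′⇒χ G χ u v w χ′v≡χ′w)

  -- With no edge inside S every edge joins S to its complement, so the layers around u alternate sides.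
  bipartite-separated : Connected G → (∀ x y → adj G x y ≡ true → S x ≡ true → S y ≡ false) →
                        ∀ u → Separated u
  bipartite-separated conn no-S-edge u v w Sv Iw χ′v≡χ′w =
    let j , j≤n , layer-v = reachable conn v
        layer-w = trans (sym (χ′-layer j v w j≤n χ′v≡χ′w)) layer-v
    in  true≢false (trans (sym Sv) (trans (layer-side j layer-v layer-w) (not-true Iw)))
    where
    open Individualised G χ u
    alternates : ∀ {x y} → adj G x y ≡ true → S x ≡ not (S y)
    alternates {x} {y} x~y with S x in Sx | S y in Sy
    ... | true  | true  = ⊥-elim (true≢false (trans (sym Sy) (no-S-edge x y x~y Sx)))
    ... | true  | false = refl
    ... | false | true  = refl
    ... | false | false = ⊥-elim (true≢false (trans (sym (covered Sx x~y)) Sy))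
    layer-side : ∀ j {x y} → layer j x ≡ true → layer j y ≡ true → S x ≡ S y
    layer-side zero    {x} {y} lx ly with x ≟ u | y ≟ u
    ... | yes refl | yes refl = refl
    layer-side (suc j) lx ly with hasNeighbour⁻ G (layer j) lx | hasNeighbour⁻ G (layer j) ly
    ... | x′ , x~x′ , lx′ | y′ , y~y′ , ly′ =
      trans (alternates x~x′) (trans (cong not (layer-side j lx′ ly′)) (sym (alternates y~y′)))

  Mixed : Fin n → Set
  Mixed v = (∃ λ s → S s ≡ true × χ s ≡ χ v) × (∃ λ i → S i ≡ false × χ i ≡ χ v)

  Candidate : Fin n → Set
  Candidate u = S u ≡ true × (∃ λ i → S i ≡ false × χ i ≡ χ u) × (∃ λ w → adj G u w ≡ true × S w ≡ true)

  candidate? : ∀ u → Dec (Candidate u)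
  candidate? u = (S u Bool.≟ true)
         ×-dec any? (λ i → (S i Bool.≟ false) ×-dec (χ i ℕ.≟ χ u))
         ×-dec any? (λ w → (adj G u w Bool.≟ true) ×-dec (S w Bool.≟ true))

  mixed-closed : ¬ (∃ Candidate) → ∀ {x y} → Mixed x → adj G x y ≡ true → Mixed y
  mixed-closed none {x} {y} ((s , Ss , χs≡χx) , (i , Si , χi≡χx)) x~y with S x in Sx
  ... | true with S y in Sy
  ...   | true  = ⊥-elim (none (x , Sx , (i , Si , χi≡χx) , y , x~y , Sy))
  ...   | false = let y′ , i~y′ , χy′≡χy = twin-neighbour (sym χi≡χx) x~y in
                  (y′ , covered Si i~y′ , χy′≡χy) , (y , Sy , refl)
  mixed-closed none {x} {y} ((s , Ss , χs≡χx) , (i , Si , χi≡χx)) x~y | false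
    with twin-neighbour (sym χs≡χx) x~y
  ... | y′ , s~y′ , χy′≡χy with S y′ in Sy′
  ...   | true  = ⊥-elim (none (s , Ss , (x , Sx , sym χs≡χx) , y′ , s~y′ , Sy′))
  ...   | false = (y , covered Sx x~y , refl) , (y′ , Sy′ , χy′≡χy)

  candidate-exists : Connected G → ∀ {a b m} → adj G a b ≡ true → S a ≡ true → S b ≡ true → Mixed m →
                     ∃ Candidate
  candidate-exists conn {a} {b} {m} a~b Sa Sb mixed-m with any? candidate?
  ... | yes candidate = candidate
  ... | no none = ⊥-elim (none (a , Sa , I-twin , b , a~b , Sb))
    where
    I-twin : ∃ λ i → S i ≡ false × χ i ≡ χ a
    I-twin = proj₂ (walk-closed Mixed (mixed-closed none) (conn m a) mixed-m)

  module WithCandidate {u i₀ w : Fin n} (Su : S u ≡ true) (Si₀ : S i₀ ≡ false) (χi₀≡χu : χ i₀ ≡ χ u)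
                       (u~w : adj G u w ≡ true) (Sw : S w ≡ true) where

    open Individualised G χ u
    open RefinedColouring S χ χ′ χ′⇒χ

    private
      w≢u : w ≢ u
      w≢u = adj⇒≢ G u~w ∘ sym

      χ′-isolates-u : ∀ {v} → v ≢ u → χ′ u ≢ χ′ v
      χ′-isolates-u v≢u = v≢u ∘ sym ∘ χ′-singleton _

      χ′-separates : ∀ {v x} → adj G u v ≡ true → adj G u x ≡ false → χ′ v ≢ χ′ x
      χ′-separates u~v u≁x χ′v≡χ′x = true≢false (trans (sym u~v) (trans (χ′-adj _ _ χ′v≡χ′x) u≁x))

      non-neighbour : ∀ {x y} → adj G u x ≡ false → adj G x y ≡ true → y ≢ u
      non-neighbour {x} u≁x x~y refl = true≢false (trans (sym x~y) (trans (Graph.sym G x u) u≁x))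

      u-new : NewlyExclusive u
      u-new = exclusive⁺ (λ v χ′v≡χ′u → subst (λ x → S x ≡ true) (χ′-singleton v (sym χ′v≡χ′u)) Su)
            , i₀ , Si₀ , χi₀≡χu

      -- The χ′-class of p lies within its χ-class and on p's side of u.
      newly-exclusive : ∀ {p i} → (∀ v → χ v ≡ χ p → adj G u v ≡ adj G u p → S v ≡ true) →
                        S i ≡ false → χ i ≡ χ p → NewlyExclusive p
      newly-exclusive {p} class⊆S Si χi≡χp =
        exclusive⁺ (λ v χ′v≡χ′p → class⊆S v (χ′⇒χ v p χ′v≡χ′p) (χ′-adj v p χ′v≡χ′p)) , _ , Si , χi≡χp

      diff+1 : ∣img-diff∣ χ S (complement S) + 1 ≤ ∣img-diff∣ χ′ S (complement S)
      diff+1 = diff-new (u ∷ []) (u-new ∷ []) ([] ∷ [])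

      diff+2 : ∀ {p} → NewlyExclusive p → p ≢ u →
               ∣img-diff∣ χ S (complement S) + 2 ≤ ∣img-diff∣ χ′ S (complement S)
      diff+2 p-new p≢u = diff-new (u ∷ _ ∷ []) (u-new ∷ p-new ∷ []) ((χ′-isolates-u p≢u ∷ []) ∷ [] ∷ [])

      w/z-split : ∀ {z} → S z ≡ true → χ z ≡ χ w → adj G u z ≡ false → ∣img∣ χ S + 1 ≤ ∣img∣ χ′ S
      w/z-split Sz χz≡χw u≁z = img-split Sw Sz (sym χz≡χw) (χ′-separates u~w u≁z)

      ClassmateOfU : Set
      ClassmateOfU = ∃ λ z′ → S z′ ≡ true × χ z′ ≡ χ u × z′ ≢ u

      classmate-of-u? : Dec ClassmateOfU
      classmate-of-u? = any? λ z′ → (S z′ Bool.≟ true) ×-dec (χ z′ ℕ.≟ χ u) ×-dec ¬? (z′ ≟ u)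

      HiddenClassmateOfW : Set
      HiddenClassmateOfW = ∃ λ z → S z ≡ true × χ z ≡ χ w × z ≢ u × adj G u z ≡ false

      hidden-classmate-of-w? : Dec HiddenClassmateOfW
      hidden-classmate-of-w? =
        any? λ z → (S z Bool.≟ true) ×-dec (χ z ℕ.≟ χ w) ×-dec ¬? (z ≟ u) ×-dec (adj G u z Bool.≟ false)

      module _ {f} (χf≡χw : χ f ≡ χ w) (u≁f : adj G u f ≡ false) (none : ¬ HiddenClassmateOfW) where

        u-sees : ∀ y → S y ≡ true → χ y ≡ χ w → y ≢ u → adj G u y ≡ true
        u-sees y Sy χy≡χw y≢u = ¬-not (λ u≁y → none (y , Sy , χy≡χw , y≢u , u≁y))

        gap-outside-S : f ≢ u → S f ≡ false
        gap-outside-S f≢u = ¬-not (λ Sf → none (f , Sf , χf≡χw , f≢u , u≁f))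

        classmate-of-u : S f ≡ false → ClassmateOfU
        classmate-of-u Sf with χ w ℕ.≟ χ u
        ... | yes χw≡χu = w , Sw , χw≡χu , w≢u
        ... | no _ = let z′ , f~z′ , χz′≡χu = twin-neighbour (sym χf≡χw) (trans (Graph.sym G w u) u~w)
                     in  z′ , covered Sf f~z′ , χz′≡χu , non-neighbour u≁f f~z′

        -- Count the χ w-coloured neighbours of whichever of f and i₀ is coloured like u.
        w-side⊆S : S f ≡ false → ∀ y → χ y ≡ χ w → adj G u y ≡ true → S y ≡ true
        w-side⊆S Sf with χ w ℕ.≟ χ u
        ... | yes χw≡χu = neighbours-in-S (χ w) Sf (trans χf≡χw χw≡χu)
                            (λ y Sy χy≡χw f~y → u-sees y Sy χy≡χw (non-neighbour u≁f f~y))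
        ... | no χw≢χu  = neighbours-in-S (χ w) Si₀ χi₀≡χu
                            (λ y Sy χy≡χw _ → u-sees y Sy χy≡χw (χw≢χu ∘ trans (sym χy≡χw) ∘ cong χ))

      -- Every vertex coloured like w has a neighbour coloured like u; for one outside S and away from u
      -- that neighbour would be a classmate of u in S.
      w-class-side⊆S : ¬ ClassmateOfU → (∀ y → χ y ≡ χ w → adj G u y ≡ true → S y ≡ true)
                                       ⊎ (∀ y → χ y ≡ χ w → adj G u y ≡ false → S y ≡ true)
      w-class-side⊆S none
        with any? (λ y → (S y Bool.≟ false) ×-dec (χ y ℕ.≟ χ w) ×-dec (adj G u y Bool.≟ true))
      ... | no no-I-near = inj₁ λ y χy≡χw u~y → ¬-not (λ Sy → no-I-near (y , Sy , χy≡χw , u~y))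
      ... | yes (y , Sy , χy≡χw , u~y) = inj₂ λ f χf≡χw u≁f → ¬-not λ Sf →
            let z , f~z , χz≡χu = twin-neighbour (trans χy≡χw (sym χf≡χw)) (trans (Graph.sym G y u) u~y)
            in  none (z , covered Sf f~z , χz≡χu , non-neighbour u≁f f~z)

    complete-pair : (∀ x → χ x ≡ χ w → x ≢ u → adj G u x ≡ true) → CompletePair
    complete-pair u-sees = χ u , χ w , (u , refl) , (w , refl) , two ,
      λ v x χv≡χu χx≡χw v≢x → complete-colour (χ w) χv≡χu u-sees x χx≡χw (v≢x ∘ sym)
      where
      two : 2 ≤ ∣preimage2∣ χ (χ u) (χ w)
      two = count≥2 _≟_ (λ v → (χ v ≡ᵇ χ u) ∨ (χ v ≡ᵇ χ w)) (∈-allFin u) (∈-allFin w) (w≢u ∘ sym)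
              (cong (_∨ (χ u ≡ᵇ χ w)) (≡⇒≡ᵇ-true (χ u) (χ u) refl))
              (trans (cong ((χ w ≡ᵇ χ u) ∨_) (≡⇒≡ᵇ-true (χ w) (χ w) refl)) (∨-zeroʳ _))

    gap-progress : ∀ {f} → χ f ≡ χ w → f ≢ u → adj G u f ≡ false → ¬ HiddenClassmateOfW → Progress u
    gap-progress {f} χf≡χw f≢u u≁f none =
      let z′ , Sz′ , χz′≡χu , z′≢u = classmate-of-u χf≡χw u≁f none Sf
      in  inj₂ (inj₁ (img-split Su Sz′ (sym χz′≡χu) (χ′-isolates-u z′≢u) , diff+2 w-new w≢u))
      where
      Sf : S f ≡ false
      Sf = gap-outside-S χf≡χw u≁f none f≢u
      w-new : NewlyExclusive w
      w-new = newly-exclusive (λ v χv≡χw eq → w-side⊆S χf≡χw u≁f none Sf v χv≡χw (trans eq u~w)) Sf χf≡χw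

    hidden-progress : HiddenClassmateOfW → Progress u
    hidden-progress (z , Sz , χz≡χw , z≢u , u≁z) with classmate-of-u?
    ... | yes (z′ , Sz′ , χz′≡χu , z′≢u) =
          inj₁ (img-split² Sz′ Su χz′≡χu (χ′-isolates-u z′≢u ∘ sym) Sw Sz (sym χz≡χw) (χ′-separates u~w u≁z)
                           (χ′-isolates-u w≢u ∘ sym) (χ′-isolates-u z≢u ∘ sym) , diff+1)
    ... | no none with any? (λ x → (S x Bool.≟ false) ×-dec (χ x ℕ.≟ χ w))
    ...   | no w-class⊆S =
            inj₂ (inj₁ (w/z-split Sz χz≡χw u≁z ,
                        diff-split-new u-new w-exclusive Sz (sym χz≡χw) (χ′-separates u~w u≁z)))
      where
      w-exclusive : Exclusive χ w
      w-exclusive = exclusive⁺ (λ v χv≡χw → ¬-not (λ Sv → w-class⊆S (v , Sv , χv≡χw)))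
    ...   | yes (x , Sx , χx≡χw) with w-class-side⊆S none
    ...     | inj₁ near⊆S = inj₂ (inj₁ (w/z-split Sz χz≡χw u≁z , diff+2 w-new w≢u))
      where
      w-new : NewlyExclusive w
      w-new = newly-exclusive (λ v χv≡χw eq → near⊆S v χv≡χw (trans eq u~w)) Sx χx≡χw
    ...     | inj₂ far⊆S  = inj₂ (inj₁ (w/z-split Sz χz≡χw u≁z , diff+2 z-new z≢u))
      where
      z-new : NewlyExclusive z
      z-new = newly-exclusive (λ v χv≡χz eq → far⊆S v (trans χv≡χz χz≡χw) (trans eq u≁z))
                              Sx (trans χx≡χw (sym χz≡χw))

    result : CompletePair ⊎ Σ (Fin n) Progress
    result with any? (λ f → (χ f ℕ.≟ χ w) ×-dec ¬? (f ≟ u) ×-dec (adj G u f Bool.≟ false))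
    ... | no no-gap = inj₁ (complete-pair λ x χx≡χw x≢u → ¬-not (λ u≁x → no-gap (x , χx≡χw , x≢u , u≁x)))
    ... | yes (f , χf≡χw , f≢u , u≁f) with hidden-classmate-of-w?
    ...   | no none    = inj₂ (u , gap-progress χf≡χw f≢u u≁f none)
    ...   | yes hidden = inj₂ (u , hidden-progress hidden)

lemma19 : ∀ {n} (G : Graph n) (χ : Coloring n) →
    2 ≤ n → Connected G → Stable G χ →
    (S : VSet n) → VertexCover G S →
    let I = complement S in
    (Σ ℕ λ c → Σ ℕ λ d →
        (∃ λ v → χ v ≡ c) × (∃ λ w → χ w ≡ d) × 2 ≤ ∣preimage2∣ χ c d ×
        (∀ v w → χ v ≡ c → χ w ≡ d → ¬ v ≡ w → adj G v w ≡ true))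
    ⊎
    (Σ (Fin n) λ u →
        let χ′ = WL1 G (individualize χ u) in
        ((∣img∣ χ S + 2 ≤ ∣img∣ χ′ S) × (∣img-diff∣ χ S I + 1 ≤ ∣img-diff∣ χ′ S I))
        ⊎ ((∣img∣ χ S + 1 ≤ ∣img∣ χ′ S) × (∣img-diff∣ χ S I + 2 ≤ ∣img-diff∣ χ′ S I))
        ⊎ (∀ v w → S v ≡ true → I w ≡ true → ¬ χ′ v ≡ χ′ w))
lemma19 G χ (s≤s _) conn stable S cover = proof
  where
  open CoveredStableGraph G χ stable S cover
  u₀ : Fin _
  u₀ = Fin.zero
  proof : CompletePair ⊎ Σ _ Progress
  proof with any? (λ a → any? (λ b → (adj G a b Bool.≟ true) ×-dec (S a Bool.≟ true) ×-dec (S b Bool.≟ true)))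
  ... | no no-S-edge = inj₂ (u₀ , inj₂ (inj₂ (bipartite-separated conn S-side u₀)))
    where
    S-side : ∀ x y → adj G x y ≡ true → S x ≡ true → S y ≡ false
    S-side x y x~y Sx = ¬-not λ Sy → no-S-edge (x , y , x~y , Sx , Sy)
  ... | yes (a , b , a~b , Sa , Sb)
    with any? (λ m → (S m Bool.≟ true) ×-dec any? (λ i → (S i Bool.≟ false) ×-dec (χ i ℕ.≟ χ m)))
  ...   | no unmixed = inj₂ (u₀ , inj₂ (inj₂ (unmixed-separated classes-apart u₀)))
    where
    classes-apart : ∀ v w → S v ≡ true → S w ≡ false → χ v ≢ χ w
    classes-apart v w Sv Sw χv≡χw = unmixed (v , Sv , w , Sw , sym χv≡χw)
  ...   | yes (m , Sm , I-twin) with candidate-exists conn a~b Sa Sb ((m , Sm , refl) , I-twin)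
  ...     | u , Su , (i₀ , Si₀ , χi₀≡χu) , (w , u~w , Sw) = WithCandidate.result Su Si₀ χi₀≡χu u~w Sw
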